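{- Let $h$, $n$, $k$ be integers with $0<h<n$ and $0<k<n/h$. Then \[ \mathcal{N}^{1/k}_n(h)=n\frac{\varphi(h)}{h}-k\varphi(h)-\sum_{d\mid h}\mu(d)\left\{\frac{n}{d}\right\}. \]
   Context: For a positive integer $n$, the Farey sequence $F_n$ is the set of irreducible fractions $a/b$ with $0<a/b\leq 1$ and $1\leq b\leq n$ (the fraction $0/1$ is excluded, $1/1$ is included). For $k>0$, $F_n^{1/k}=\{\alpha\in F_n:\alpha<1/k\}$, and $\mathcal{N}^{1/k}_n(h)$ denotes the number of fractions in $F_n^{1/k}$ whose (reduced) numerator equals $h$. $\varphi$ is Euler's totient function, $\mu$ the Möbius function, and $\{x\}=x-\lfloor x\rfloor$ the fractional part. -}

module Defs where

open import Data.Nat as ℕ using (ℕ; zero; suc; _≤?_; _<?_; _≟_)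
open import Data.Nat.Divisibility using (_∣?_)
open import Data.Nat.GCD using (gcd)
open import Data.Nat.Primality using (prime?)
open import Data.List using (List; []; _∷_; length; filter; map; concatMap; foldr)
open import Data.List.Base using (upTo)
open import Data.Product using (_×_; _,_; proj₁; proj₂)
open import Relation.Nullary.Decidable using (_×-dec_; yes; no)
open import Data.Integer as ℤ using (ℤ; +_)
open import Data.Rational as ℚ using (ℚ; 0ℚ; floor)

range1 : ℕ → List ℕ
range1 n = map suc (upTo n)

-- Farey sequence F_n as list of pairs (a , b) representing a/b:
-- irreducible (gcd a b = 1), 0 < a/b ≤ 1 (i.e. 1 ≤ a ≤ b), 1 ≤ b ≤ n.
farey : ℕ → List (ℕ × ℕ)
farey n = filter (λ p → (proj₁ p ℕ.≤? proj₂ p) ×-dec (gcd (proj₁ p) (proj₂ p) ≟ 1))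
                 (concatMap (λ b → map (λ a → (a , b)) (range1 b)) (range1 n))

-- F_n^{1/k} : fractions a/b in F_n with a/b < 1/k  (⇔ a * k < b, for k > 0)
fareyBelow : ℕ → ℕ → List (ℕ × ℕ)
fareyBelow n k = filter (λ p → (proj₁ p ℕ.* k) ℕ.<? proj₂ p) (farey n)

𝒩 : ℕ → ℕ → ℕ → ℕ
𝒩 n k h = length (filter (λ p → proj₁ p ≟ h) (fareyBelow n k))

φ : ℕ → ℕ
φ n = length (filter (λ m → gcd m n ≟ 1) (range1 n))

divisors : ℕ → List ℕ
divisors n = filter (λ d → d ∣? n) (range1 n)

squareful : ℕ → ℕ
squareful d = length (filter (λ m → (2 ℕ.≤? m) ×-dec ((m ℕ.* m) ∣? d)) (range1 d))

ω : ℕ → ℕ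
ω d = length (filter (λ p → prime? p ×-dec (p ∣? d)) (range1 d))

negOnePow : ℕ → ℤ
negOnePow zero = ℤ.+ 1
negOnePow (suc m) = ℤ.- negOnePow m

μ : ℕ → ℤ
μ d with squareful d
... | zero = negOnePow (ω d)
... | suc _ = ℤ.+ 0

frac : ℚ → ℚ
frac x = x ℚ.- ((floor x) ℚ./ 1)

-- rational number m/d for naturals (d ≥ 1 is needed; d = 0 gives 0)
_⟋_ : ℕ → ℕ → ℚ
m ⟋ zero = 0ℚ
m ⟋ suc d = (+ m) ℚ./ suc d

sumℚ : List ℚ → ℚ
sumℚ = foldr ℚ._+_ 0ℚ

-- Sorted by denominator, the fractions h/b of F_n^{1/k} are exactly those with hk < b ≤ n and
-- gcd(b, h) = 1, so 𝒩 = C(n) − C(hk), where C(N) counts the b ≤ N coprime to h. Möbius inversion,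
-- Σ_{d∣g} μ(d) = [g = 1], gives C(N) = Σ_{d∣h} μ(d)⌊N/d⌋; hence C(hk) = kφ(h), and writing
-- ⌊n/d⌋ = n/d − {n/d} together with Σ_{d∣h} μ(d)/d = φ(h)/h gives C(n) = nφ(h)/h − Σ_{d∣h} μ(d){n/d}.
module Submission where

open import Defs
open import Data.Nat using (ℕ; _<_; _*_)
open import Data.List using (map)
open import Data.Integer using (+_)
open import Data.Rational using (ℚ; _+_; _-_; _/_)
open import Relation.Binary.PropositionalEquality using (_≡_)

open import Data.Empty using (⊥-elim)
open import Data.Integer as ℤ using (ℤ; 0ℤ; 1ℤ)
import Data.Integer.Properties as ℤₚ
open import Data.Integer.DivMod using (div-pos-is-/ℕ)
open import Data.Integer.Tactic.RingSolver using (solve-∀)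
open import Data.List using (List; []; _∷_; _++_; [_]; length; filter; concatMap; upTo)
import Data.List.Properties as Listₚ
open import Data.List.Membership.Propositional using (_∈_; lose)
open import Data.List.Membership.Propositional.Properties using (∈-map⁺; ∈-upTo⁺)
open import Data.List.Relation.Unary.All using (_∷_)
open import Data.List.Relation.Unary.All.Properties using (¬Any⇒All¬)
open import Data.List.Relation.Unary.Any using (any?; satisfied)
open import Data.Nat using (zero; suc; _≤_; z≤n; s≤s; NonZero; _≟_; _≤?_; _<?_)
import Data.Nat as ℕ
import Data.Nat.Properties as ℕₚ
open import Data.Nat.Coprimality using (Coprime; coprime-divisor)
open import Data.Nat.Divisibility
open import Data.Nat.DivMod using (m≡m%n+[m/n]*n; m%n<n; *-/-assoc; m*n/o*n≡m/o; m*n/n≡m; /-congˡ; /-congʳ)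
open import Data.Nat.GCD using (gcd; gcd-comm; gcd-greatest; gcd[m,n]∣m; gcd[m,n]∣n; gcd[m,n]≤n; gcd[m,n]≡0⇒n≡0)
open import Data.Nat.Primality
  using (Prime; prime?; euclidsLemma; prime⇒irreducible; prime⇒nonZero; prime⇒nonTrivial; ¬prime[1])
open import Data.Nat.Primality.Factorisation using (factorise)
open import Data.Product using (_×_; _,_; proj₁; proj₂; ∃-syntax)
open import Data.Rational as ℚ using (0ℚ)
import Data.Rational.Properties as ℚₚ
open import Data.Rational.Solver using (module +-*-Solver)
open import Data.Rational.Unnormalised as ℚᵘ using (mkℚᵘ; *≡*)
import Data.Rational.Unnormalised.Properties as ℚᵘₚ
open import Data.Sum as Sum using (inj₁; inj₂)
open import Function using (_∘_; id)
open import Level using (0ℓ)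
open import Relation.Binary.PropositionalEquality
  using (refl; sym; trans; cong; cong₂; subst; _≢_; module ≡-Reasoning)
open import Relation.Nullary using (Dec; yes; no; ¬_; ¬?)
open import Relation.Nullary.Decidable using (_×-dec_)
open import Relation.Unary using (Pred; Decidable)

⟦_⟧_ : {A : Set} → Dec A → ℤ → ℤ
⟦ yes _ ⟧ x = x
⟦ no  _ ⟧ x = 0ℤ

⟦⟧-yes : {A : Set} (a? : Dec A) {x : ℤ} → A → ⟦ a? ⟧ x ≡ x
⟦⟧-yes (yes _) a = refl
⟦⟧-yes (no ¬a) a = ⊥-elim (¬a a)

⟦⟧-no : {A : Set} (a? : Dec A) {x : ℤ} → ¬ A → ⟦ a? ⟧ x ≡ 0ℤ
⟦⟧-no (yes a) ¬a = ⊥-elim (¬a a)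
⟦⟧-no (no _)  ¬a = refl

⟦⟧-⇔ : {A B : Set} (a? : Dec A) (b? : Dec B) {x : ℤ} → (A → B) → (B → A) → ⟦ a? ⟧ x ≡ ⟦ b? ⟧ x
⟦⟧-⇔ (yes a) (yes b) f g = refl
⟦⟧-⇔ (yes a) (no ¬b) f g = ⊥-elim (¬b (f a))
⟦⟧-⇔ (no ¬a) (yes b) f g = ⊥-elim (¬a (g b))
⟦⟧-⇔ (no ¬a) (no ¬b) f g = refl

⟦⟧-0ℤ : {A : Set} (a? : Dec A) → ⟦ a? ⟧ 0ℤ ≡ 0ℤ
⟦⟧-0ℤ (yes _) = refl
⟦⟧-0ℤ (no _)  = refl

⟦⟧-scale : {A : Set} (a? : Dec A) (x : ℤ) → ⟦ a? ⟧ x ≡ x ℤ.* ⟦ a? ⟧ 1ℤ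
⟦⟧-scale (yes _) x = sym (ℤₚ.*-identityʳ x)
⟦⟧-scale (no _)  x = sym (ℤₚ.*-zeroʳ x)

⟦⟧-split : {B : Set} (b? : Dec B) (x : ℤ) → x ≡ ⟦ ¬? b? ⟧ x ℤ.+ ⟦ b? ⟧ x
⟦⟧-split (yes _) x = sym (ℤₚ.+-identityˡ x)
⟦⟧-split (no _)  x = sym (ℤₚ.+-identityʳ x)

⟦⟧-*ˡ : {A : Set} (a? : Dec A) (x y : ℤ) → ⟦ a? ⟧ (x ℤ.* y) ≡ x ℤ.* ⟦ a? ⟧ y
⟦⟧-*ˡ (yes _) x y = refl
⟦⟧-*ˡ (no _)  x y = sym (ℤₚ.*-zeroʳ x)

-- Finite sums

∑ : ℕ → (ℕ → ℤ) → ℤ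
∑ zero    f = 0ℤ
∑ (suc N) f = ∑ N f ℤ.+ f (suc N)

∑-cong : ∀ N {f g : ℕ → ℤ} → (∀ i → 1 ≤ i → i ≤ N → f i ≡ g i) → ∑ N f ≡ ∑ N g
∑-cong zero    f≡g = refl
∑-cong (suc N) f≡g =
  cong₂ ℤ._+_ (∑-cong N λ i 1≤i i≤N → f≡g i 1≤i (ℕₚ.m≤n⇒m≤1+n i≤N)) (f≡g (suc N) (s≤s z≤n) ℕₚ.≤-refl)

∑-zero : ∀ N {f : ℕ → ℤ} → (∀ i → 1 ≤ i → i ≤ N → f i ≡ 0ℤ) → ∑ N f ≡ 0ℤ
∑-zero zero    f≡0 = refl
∑-zero (suc N) f≡0 =
  cong₂ ℤ._+_ (∑-zero N λ i 1≤i i≤N → f≡0 i 1≤i (ℕₚ.m≤n⇒m≤1+n i≤N)) (f≡0 (suc N) (s≤s z≤n) ℕₚ.≤-refl)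

∑-+ : ∀ N (f g : ℕ → ℤ) → ∑ N (λ i → f i ℤ.+ g i) ≡ ∑ N f ℤ.+ ∑ N g
∑-+ zero    f g = refl
∑-+ (suc N) f g rewrite ∑-+ N f g = swap (∑ N f) (∑ N g) (f (suc N)) (g (suc N))
  where
  swap : ∀ a b c d → a ℤ.+ b ℤ.+ (c ℤ.+ d) ≡ a ℤ.+ c ℤ.+ (b ℤ.+ d)
  swap = solve-∀

∑-*ˡ : ∀ N c (f : ℕ → ℤ) → ∑ N (λ i → c ℤ.* f i) ≡ c ℤ.* ∑ N f
∑-*ˡ zero    c f = sym (ℤₚ.*-zeroʳ c)
∑-*ˡ (suc N) c f rewrite ∑-*ˡ N c f = sym (ℤₚ.*-distribˡ-+ c (∑ N f) (f (suc N)))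

∑-neg : ∀ N (f : ℕ → ℤ) → ∑ N (λ i → ℤ.- f i) ≡ ℤ.- ∑ N f
∑-neg zero    f = refl
∑-neg (suc N) f rewrite ∑-neg N f = sym (ℤₚ.neg-distrib-+ (∑ N f) (f (suc N)))

∑-++ : ∀ M N (f : ℕ → ℤ) → ∑ (M ℕ.+ N) f ≡ ∑ M f ℤ.+ ∑ N (λ i → f (M ℕ.+ i))
∑-++ M zero    f rewrite ℕₚ.+-identityʳ M = sym (ℤₚ.+-identityʳ _)
∑-++ M (suc N) f rewrite ℕₚ.+-suc M N | ∑-++ M N f = ℤₚ.+-assoc (∑ M f) _ _

∑-comm : ∀ M N (f : ℕ → ℕ → ℤ) → ∑ M (λ i → ∑ N (f i)) ≡ ∑ N (λ j → ∑ M (λ i → f i j))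
∑-comm zero    N f = sym (∑-zero N λ _ _ _ → refl)
∑-comm (suc M) N f rewrite ∑-comm M N f = sym (∑-+ N (λ j → ∑ M (λ i → f i j)) (f (suc M)))

∑-from : ∀ {M N} (f : ℕ → ℤ) → M ≤ N → ∑ N f ≡ ∑ M f ℤ.+ ∑ N (λ i → ⟦ M <? i ⟧ f i)
∑-from {M} {N} f M≤N = begin
  ∑ N f                              ≡⟨ cong (λ x → ∑ x f) N≡M+r ⟩
  ∑ (M ℕ.+ r) f                      ≡⟨ ∑-++ M r f ⟩
  ∑ M f ℤ.+ ∑ r (λ i → f (M ℕ.+ i))  ≡⟨ cong (λ x → ∑ M f ℤ.+ x) (sym tail) ⟩
  ∑ M f ℤ.+ ∑ N G                    ∎
  where
  open ≡-Reasoning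
  r : ℕ
  r = N ℕ.∸ M
  N≡M+r : N ≡ M ℕ.+ r
  N≡M+r = sym (ℕₚ.m+[n∸m]≡n M≤N)
  G : ℕ → ℤ
  G i = ⟦ M <? i ⟧ f i
  tail : ∑ N G ≡ ∑ r (λ i → f (M ℕ.+ i))
  tail = begin
    ∑ N G                                  ≡⟨ cong (λ x → ∑ x G) N≡M+r ⟩
    ∑ (M ℕ.+ r) G                          ≡⟨ ∑-++ M r G ⟩
    ∑ M G ℤ.+ ∑ r (λ i → G (M ℕ.+ i))      ≡⟨ cong₂ ℤ._+_ (∑-zero M λ i _ i≤M → ⟦⟧-no (M <? i) (ℕₚ.≤⇒≯ i≤M))
                                                          (∑-cong r λ i 1≤i _ → ⟦⟧-yes (M <? _) (ℕₚ.m<m+n M 1≤i)) ⟩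
    0ℤ ℤ.+ ∑ r (λ i → f (M ℕ.+ i))         ≡⟨ ℤₚ.+-identityˡ _ ⟩
    ∑ r (λ i → f (M ℕ.+ i))                ∎

∑-extend : ∀ {M N} {f : ℕ → ℤ} → M ≤ N → (∀ i → M < i → i ≤ N → f i ≡ 0ℤ) → ∑ N f ≡ ∑ M f
∑-extend {M} {N} {f} M≤N beyond-M≡0 = begin
  ∑ N f                                  ≡⟨ ∑-from f M≤N ⟩
  ∑ M f ℤ.+ ∑ N (λ i → ⟦ M <? i ⟧ f i)   ≡⟨ cong (λ x → ∑ M f ℤ.+ x) (∑-zero N tail≡0) ⟩
  ∑ M f ℤ.+ 0ℤ                           ≡⟨ ℤₚ.+-identityʳ _ ⟩
  ∑ M f                                  ∎
  where
  open ≡-Reasoning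
  tail≡0 : ∀ i → 1 ≤ i → i ≤ N → ⟦ M <? i ⟧ f i ≡ 0ℤ
  tail≡0 i _ i≤N with M <? i
  ... | yes M<i = beyond-M≡0 i M<i i≤N
  ... | no  _   = refl

∑-single : ∀ N j {f : ℕ → ℤ} → 1 ≤ j → j ≤ N → (∀ i → 1 ≤ i → i ≤ N → i ≢ j → f i ≡ 0ℤ) → ∑ N f ≡ f j
∑-single zero    zero () _ _
∑-single (suc N) j {f} 1≤j j≤1+N others≡0 with j ≟ suc N
... | yes refl = trans (cong (ℤ._+ f (suc N))
                              (∑-zero N λ i 1≤i i≤N → others≡0 i 1≤i (ℕₚ.m≤n⇒m≤1+n i≤N) (ℕₚ.<⇒≢ (s≤s i≤N))))
                       (ℤₚ.+-identityˡ _)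
... | no j≢1+N = trans (cong₂ ℤ._+_ (∑-single N j 1≤j (ℕₚ.≤-pred (ℕₚ.≤∧≢⇒< j≤1+N j≢1+N))
                                       λ i 1≤i i≤N → others≡0 i 1≤i (ℕₚ.m≤n⇒m≤1+n i≤N))
                                    (others≡0 (suc N) (s≤s z≤n) ℕₚ.≤-refl (j≢1+N ∘ sym)))
                       (ℤₚ.+-identityʳ _)

∤-*+ : ∀ {p} m {i} → 1 ≤ i → i < p → ¬ (p ∣ m * p ℕ.+ i)
∤-*+ m {suc _} _ i<p p∣mp+i = ℕₚ.<⇒≱ i<p (∣⇒≤ (∣m+n∣m⇒∣n p∣mp+i (n∣m*n m)))

∑-multiples : ∀ p .{{_ : NonZero p}} m (F : ℕ → ℤ) → ∑ (m * p) (λ i → ⟦ p ∣? i ⟧ F i) ≡ ∑ m (λ e → F (e * p))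
∑-multiples p zero    F = refl
∑-multiples p (suc m) F = begin
  ∑ (p ℕ.+ m * p) G                             ≡⟨ cong (λ x → ∑ x G) (ℕₚ.+-comm p (m * p)) ⟩
  ∑ (m * p ℕ.+ p) G                             ≡⟨ ∑-++ (m * p) p G ⟩
  ∑ (m * p) G ℤ.+ ∑ p (λ i → G (m * p ℕ.+ i))  ≡⟨ cong₂ ℤ._+_ (∑-multiples p m F)
                                                              (∑-single p p 1≤p ℕₚ.≤-refl non-multiples) ⟩
  ∑ m (λ e → F (e * p)) ℤ.+ G (m * p ℕ.+ p)     ≡⟨ cong (λ x → ∑ m (λ e → F (e * p)) ℤ.+ x) last ⟩
  ∑ m (λ e → F (e * p)) ℤ.+ F (p ℕ.+ m * p)     ∎
  where
  open ≡-Reasoning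
  G : ℕ → ℤ
  G i = ⟦ p ∣? i ⟧ F i
  1≤p : 1 ≤ p
  1≤p = ℕ.>-nonZero⁻¹ p
  non-multiples : ∀ i → 1 ≤ i → i ≤ p → i ≢ p → G (m * p ℕ.+ i) ≡ 0ℤ
  non-multiples i 1≤i i≤p i≢p = ⟦⟧-no (p ∣? _) (∤-*+ m 1≤i (ℕₚ.≤∧≢⇒< i≤p i≢p))
  last : G (m * p ℕ.+ p) ≡ F (p ℕ.+ m * p)
  last = trans (⟦⟧-yes (p ∣? _) (∣m∣n⇒∣m+n (n∣m*n m) ∣-refl)) (cong F (ℕₚ.+-comm (m * p) p))

∑-1 : ∀ q → ∑ q (λ _ → 1ℤ) ≡ + q
∑-1 zero    = refl
∑-1 (suc q) = trans (cong (ℤ._+ 1ℤ) (∑-1 q)) (cong +_ (ℕₚ.+-comm q 1))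

count-multiples : ∀ N d .{{_ : NonZero d}} → ∑ N (λ b → ⟦ d ∣? b ⟧ 1ℤ) ≡ + (N ℕ./ d)
count-multiples N d = begin
  ∑ N G                                      ≡⟨ cong (λ x → ∑ x G) N≡qd+r ⟩
  ∑ (q * d ℕ.+ r) G                          ≡⟨ ∑-++ (q * d) r G ⟩
  ∑ (q * d) G ℤ.+ ∑ r (λ i → G (q * d ℕ.+ i)) ≡⟨ cong₂ ℤ._+_ (∑-multiples d q _) (∑-zero r remainder≡0) ⟩
  ∑ q (λ _ → 1ℤ) ℤ.+ 0ℤ                      ≡⟨ trans (ℤₚ.+-identityʳ _) (∑-1 q) ⟩
  + q                                        ∎
  where
  open ≡-Reasoning
  G : ℕ → ℤ
  G b = ⟦ d ∣? b ⟧ 1ℤ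
  q r : ℕ
  q = N ℕ./ d
  r = N ℕ.% d
  N≡qd+r : N ≡ q * d ℕ.+ r
  N≡qd+r = trans (m≡m%n+[m/n]*n N d) (ℕₚ.+-comm r (q * d))
  remainder≡0 : ∀ i → 1 ≤ i → i ≤ r → G (q * d ℕ.+ i) ≡ 0ℤ
  remainder≡0 i 1≤i i≤r = ⟦⟧-no (d ∣? _) (∤-*+ q 1≤i (ℕₚ.<-≤-trans (s≤s i≤r) (m%n<n N d)))

range1-suc : ∀ N → range1 (suc N) ≡ range1 N ++ [ suc N ]
range1-suc N = trans (cong (map suc) (sym (Listₚ.upTo-∷ʳ N))) (Listₚ.map-++ suc (upTo N) [ N ])

∈-range1 : ∀ {m N} → 1 ≤ m → m ≤ N → m ∈ range1 N
∈-range1 {suc m} _ m<N = ∈-map⁺ suc (∈-upTo⁺ m<N)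

module _ {A : Set} {P Q : Pred A 0ℓ} (P? : Decidable P) (Q? : Decidable Q) where

  filter-filter : ∀ xs → filter P? (filter Q? xs) ≡ filter (λ x → Q? x ×-dec P? x) xs
  filter-filter [] = refl
  filter-filter (x ∷ xs) with Q? x
  ... | no _ = filter-filter xs
  ... | yes _ with P? x
  ...   | yes _ = cong (x ∷_) (filter-filter xs)
  ...   | no _  = filter-filter xs

module _ {A B : Set} {P : Pred B 0ℓ} (P? : Decidable P) (f : A → B) where

  length-filter-map : ∀ xs → length (filter P? (map f xs)) ≡ length (filter (P? ∘ f) xs)
  length-filter-map [] = refl
  length-filter-map (x ∷ xs) with P? (f x)
  ... | yes _ = cong suc (length-filter-map xs)
  ... | no _  = length-filter-map xs

length-filter-[-] : {A : Set} {P : Pred A 0ℓ} (P? : Decidable P) → ∀ x → + length (filter P? [ x ]) ≡ ⟦ P? x ⟧ 1ℤ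
length-filter-[-] P? x with P? x
... | yes _ = refl
... | no _  = refl

length-filter-concatMap-range1 : {A : Set} {P : Pred A 0ℓ} (P? : Decidable P) (g : ℕ → List A) → ∀ N →
  + length (filter P? (concatMap g (range1 N))) ≡ ∑ N (λ b → + length (filter P? (g b)))
length-filter-concatMap-range1 P? g zero    = refl
length-filter-concatMap-range1 P? g (suc N) = begin
  + length (filter P? (concatMap g (range1 (suc N))))
      ≡⟨ cong (λ l → + length (filter P? l)) concatMap-range1-suc ⟩
  + length (filter P? (concatMap g (range1 N) ++ g (suc N)))
      ≡⟨ cong (λ l → + length l) (Listₚ.filter-++ P? (concatMap g (range1 N)) (g (suc N))) ⟩
  + length (filter P? (concatMap g (range1 N)) ++ filter P? (g (suc N)))
      ≡⟨ cong +_ (Listₚ.length-++ (filter P? (concatMap g (range1 N)))) ⟩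
  + length (filter P? (concatMap g (range1 N))) ℤ.+ + length (filter P? (g (suc N)))
      ≡⟨ cong (ℤ._+ + length (filter P? (g (suc N)))) (length-filter-concatMap-range1 P? g N) ⟩
  ∑ N (λ b → + length (filter P? (g b))) ℤ.+ + length (filter P? (g (suc N))) ∎
  where
  open ≡-Reasoning
  concatMap-range1-suc : concatMap g (range1 (suc N)) ≡ concatMap g (range1 N) ++ g (suc N)
  concatMap-range1-suc = begin
    concatMap g (range1 (suc N))                    ≡⟨ cong (concatMap g) (range1-suc N) ⟩
    concatMap g (range1 N ++ [ suc N ])             ≡⟨ Listₚ.concatMap-++ g (range1 N) _ ⟩
    concatMap g (range1 N) ++ (g (suc N) ++ [])     ≡⟨ cong (concatMap g (range1 N) ++_) (Listₚ.++-identityʳ (g (suc N))) ⟩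
    concatMap g (range1 N) ++ g (suc N)             ∎

length-filter-range1 : {P : Pred ℕ 0ℓ} (P? : Decidable P) → ∀ N → + length (filter P? (range1 N)) ≡ ∑ N (λ i → ⟦ P? i ⟧ 1ℤ)
length-filter-range1 P? N = begin
  + length (filter P? (range1 N))                  ≡⟨ cong (λ l → + length (filter P? l)) (sym (Listₚ.concatMap-pure (range1 N))) ⟩
  + length (filter P? (concatMap [_] (range1 N)))  ≡⟨ length-filter-concatMap-range1 P? [_] N ⟩
  ∑ N (λ i → + length (filter P? [ i ]))           ≡⟨ ∑-cong N (λ i _ _ → length-filter-[-] P? i) ⟩
  ∑ N (λ i → ⟦ P? i ⟧ 1ℤ)                          ∎
  where open ≡-Reasoning

-- Primes and the Möbius function

prime⇒2≤ : ∀ {p} → Prime p → 2 ≤ p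
prime⇒2≤ {p} p-prime = ℕ.nonTrivial⇒n>1 p {{prime⇒nonTrivial p-prime}}

prime⇒1≤ : ∀ {p} → Prime p → 1 ≤ p
prime⇒1≤ p-prime = ℕₚ.<⇒≤ (prime⇒2≤ p-prime)

∣-prime⇒≡ : ∀ {p q} → Prime p → Prime q → q ∣ p → q ≡ p
∣-prime⇒≡ p-prime q-prime q∣p with prime⇒irreducible p-prime q∣p
... | inj₁ refl = ⊥-elim (¬prime[1] q-prime)
... | inj₂ q≡p  = q≡p

∤-prime⇒coprime : ∀ {p d} → Prime p → ¬ p ∣ d → Coprime d p
∤-prime⇒coprime p-prime p∤d (i∣d , i∣p) with prime⇒irreducible p-prime i∣p
... | inj₁ i≡1 = i≡1
... | inj₂ refl = ⊥-elim (p∤d i∣d)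

∃-prime-divisor : ∀ g → 2 ≤ g → ∃[ p ] (Prime p × p ∣ g)
∃-prime-divisor g 2≤g with factorise g {{ℕ.>-nonZero (ℕₚ.<⇒≤ 2≤g)}}
... | record { factors = [] ; isFactorisation = g≡1 } = ⊥-elim (ℕₚ.<⇒≢ 2≤g (sym g≡1))
... | record { factors = p ∷ _ ; isFactorisation = g≡∏factors ; factorsPrime = p-prime ∷ _ } =
  p , p-prime , subst (p ∣_) (sym g≡∏factors) (m∣m*n _)

squareDivisor? : ∀ d → Decidable (λ m → 2 ≤ m × m * m ∣ d)
squareDivisor? d m = (2 ℕ.≤? m) ×-dec ((m * m) ∣? d)

squareful-≢0 : ∀ {d m} → 1 ≤ d → 2 ≤ m → m * m ∣ d → squareful d ≢ 0
squareful-≢0 {d} {m} 1≤d 2≤m m²∣d squareful≡0 =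
  ℕₚ.<⇒≢ (Listₚ.filter-some (squareDivisor? d) (lose m∈range1 (2≤m , m²∣d))) (sym squareful≡0)
  where
  1≤m : 1 ≤ m
  1≤m = ℕₚ.<⇒≤ 2≤m
  m∈range1 : m ∈ range1 d
  m∈range1 = ∈-range1 1≤m (ℕₚ.≤-trans (ℕₚ.m≤m*n m m {{ℕ.>-nonZero 1≤m}}) (∣⇒≤ {{ℕ.>-nonZero 1≤d}} m²∣d))

squareful-witness : ∀ d → squareful d ≢ 0 → ∃[ m ] (2 ≤ m × m * m ∣ d)
squareful-witness d squareful≢0 with any? (squareDivisor? d) (range1 d)
... | yes some = satisfied some
... | no  none = ⊥-elim (squareful≢0 (cong length (Listₚ.filter-none (squareDivisor? d) (¬Any⇒All¬ _ none))))

μ-squarefree : ∀ d → squareful d ≡ 0 → μ d ≡ negOnePow (ω d)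
μ-squarefree d _ with squareful d
μ-squarefree d _  | zero  = refl
μ-squarefree d () | suc _

μ-squareful : ∀ d → squareful d ≢ 0 → μ d ≡ 0ℤ
μ-squareful d squareful≢0 with squareful d
... | zero  = ⊥-elim (squareful≢0 refl)
... | suc _ = refl

prime∤⇒∤square : ∀ {p m} → Prime p → ¬ p ∣ m → ¬ p ∣ m * m
prime∤⇒∤square p-prime p∤m p∣m² = Sum.[ p∤m , p∤m ] (euclidsLemma _ _ p-prime p∣m²)

squareful-*-prime : ∀ {p e} → Prime p → 1 ≤ e → ¬ p ∣ e → squareful e ≡ 0 → squareful (p * e) ≡ 0
squareful-*-prime {p} {e} p-prime 1≤e p∤e squareful≡0 with squareful (p * e) ℕ.≟ 0
... | yes squareful′≡0 = squareful′≡0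
... | no  squareful′≢0 with squareful-witness (p * e) squareful′≢0
...   | m , 2≤m , m²∣pe with p ∣? m
...     | yes p∣m = ⊥-elim (p∤e (*-cancelˡ-∣ p {{prime⇒nonZero p-prime}} (∣-trans (*-pres-∣ p∣m p∣m) m²∣pe)))
...     | no  p∤m = ⊥-elim (squareful-≢0 1≤e 2≤m m²∣e squareful≡0)
  where
  m²∣e : m * m ∣ e
  m²∣e = coprime-divisor (∤-prime⇒coprime p-prime (prime∤⇒∤square p-prime p∤m)) m²∣pe

primeDivisor? : ∀ d → Decidable (λ q → Prime q × q ∣ d)
primeDivisor? d q = prime? q ×-dec (q ∣? d)

primeDivisor-*-prime : ∀ {p e} → Prime p → ¬ p ∣ e → ∀ q →
  ⟦ primeDivisor? (p * e) q ⟧ 1ℤ ≡ ⟦ primeDivisor? e q ⟧ 1ℤ ℤ.+ ⟦ q ≟ p ⟧ 1ℤ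
primeDivisor-*-prime {p} {e} p-prime p∤e q with q ≟ p
... | yes refl = trans (⟦⟧-yes (primeDivisor? (p * e) p) (p-prime , m∣m*n e))
                       (cong (ℤ._+ 1ℤ) (sym (⟦⟧-no (primeDivisor? e p) (p∤e ∘ proj₂))))
... | no  q≢p  = trans (⟦⟧-⇔ (primeDivisor? (p * e) q) (primeDivisor? e q)
                          (λ (q-prime , q∣pe) → q-prime , q∣e q-prime q∣pe)
                          (λ (q-prime , q∣e) → q-prime , ∣-trans q∣e (n∣m*n p)))
                       (sym (ℤₚ.+-identityʳ _))
  where
  q∣e : Prime q → q ∣ p * e → q ∣ e
  q∣e q-prime q∣pe = Sum.[ ⊥-elim ∘ q≢p ∘ ∣-prime⇒≡ p-prime q-prime , id ] (euclidsLemma p e q-prime q∣pe)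

ω-*-prime : ∀ {p e} → Prime p → 1 ≤ e → ¬ p ∣ e → ω (p * e) ≡ suc (ω e)
ω-*-prime {p} {e} p-prime 1≤e p∤e = ℤₚ.+-injective (begin
  + ω (p * e)                                       ≡⟨ length-filter-range1 (primeDivisor? (p * e)) (p * e) ⟩
  ∑ (p * e) (χ (p * e))                             ≡⟨ ∑-cong (p * e) (λ q _ _ → primeDivisor-*-prime p-prime p∤e q) ⟩
  ∑ (p * e) (λ q → χ e q ℤ.+ ⟦ q ≟ p ⟧ 1ℤ)          ≡⟨ ∑-+ (p * e) _ _ ⟩
  ∑ (p * e) (χ e) ℤ.+ ∑ (p * e) (λ q → ⟦ q ≟ p ⟧ 1ℤ) ≡⟨ cong₂ ℤ._+_ (∑-extend e≤pe beyond-e) only-p ⟩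
  ∑ e (χ e) ℤ.+ 1ℤ                                  ≡⟨ cong (ℤ._+ 1ℤ) (sym (length-filter-range1 (primeDivisor? e) e)) ⟩
  + ω e ℤ.+ 1ℤ                                      ≡⟨ cong +_ (ℕₚ.+-comm (ω e) 1) ⟩
  + suc (ω e)                                       ∎)
  where
  open ≡-Reasoning
  χ : ℕ → ℕ → ℤ
  χ d q = ⟦ primeDivisor? d q ⟧ 1ℤ
  1≤p : 1 ≤ p
  1≤p = prime⇒1≤ p-prime
  e≤pe : e ≤ p * e
  e≤pe = ℕₚ.m≤n*m e p {{ℕ.>-nonZero 1≤p}}
  beyond-e : ∀ q → e < q → q ≤ p * e → χ e q ≡ 0ℤ
  beyond-e q e<q _ = ⟦⟧-no (primeDivisor? e q) (ℕₚ.<⇒≱ e<q ∘ ∣⇒≤ {{ℕ.>-nonZero 1≤e}} ∘ proj₂)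
  only-p : ∑ (p * e) (λ q → ⟦ q ≟ p ⟧ 1ℤ) ≡ 1ℤ
  only-p = trans (∑-single (p * e) p 1≤p (ℕₚ.m≤m*n p e {{ℕ.>-nonZero 1≤e}}) λ q _ _ q≢p → ⟦⟧-no (q ≟ p) q≢p)
                 (⟦⟧-yes (p ≟ p) refl)

μ-*-prime-∣ : ∀ {p e} → Prime p → 1 ≤ e → p ∣ e → μ (p * e) ≡ 0ℤ
μ-*-prime-∣ {p} {e} p-prime 1≤e p∣e =
  μ-squareful (p * e) (squareful-≢0 (ℕₚ.*-mono-≤ (prime⇒1≤ p-prime) 1≤e) (prime⇒2≤ p-prime) (*-monoʳ-∣ p p∣e))

μ-*-prime-∤ : ∀ {p e} → Prime p → 1 ≤ e → ¬ p ∣ e → μ (p * e) ≡ ℤ.- μ e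
μ-*-prime-∤ {p} {e} p-prime 1≤e p∤e with squareful e ≟ 0
... | yes squareful≡0 = begin
  μ (p * e)               ≡⟨ μ-squarefree (p * e) (squareful-*-prime p-prime 1≤e p∤e squareful≡0) ⟩
  negOnePow (ω (p * e))   ≡⟨ cong negOnePow (ω-*-prime p-prime 1≤e p∤e) ⟩
  ℤ.- negOnePow (ω e)     ≡⟨ cong ℤ.-_ (sym (μ-squarefree e squareful≡0)) ⟩
  ℤ.- μ e                 ∎
  where open ≡-Reasoning
... | no squareful≢0 with squareful-witness e squareful≢0
...   | m , 2≤m , m²∣e = trans (μ-squareful (p * e) (squareful-≢0 1≤pe 2≤m (∣-trans m²∣e (n∣m*n p))))
                               (cong ℤ.-_ (sym (μ-squareful e squareful≢0)))
  where
  1≤pe : 1 ≤ p * e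
  1≤pe = ℕₚ.*-mono-≤ (prime⇒1≤ p-prime) 1≤e

divisorSum : ℕ → (ℕ → ℤ) → ℤ
divisorSum h f = ∑ h (λ d → ⟦ d ∣? h ⟧ f d)

⟦∤prime⟧-μ-divisor : ∀ {p} → Prime p → ∀ m d →
  ⟦ ¬? (p ∣? d) ⟧ ⟦ d ∣? m * p ⟧ μ d ≡ ⟦ d ∣? m ⟧ ⟦ ¬? (p ∣? d) ⟧ μ d
⟦∤prime⟧-μ-divisor {p} p-prime m d with p ∣? d
... | yes _  = sym (⟦⟧-0ℤ (d ∣? m))
... | no p∤d = ⟦⟧-⇔ (d ∣? m * p) (d ∣? m)
  (λ d∣mp → coprime-divisor (∤-prime⇒coprime p-prime p∤d) (subst (d ∣_) (ℕₚ.*-comm m p) d∣mp))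
  (λ d∣m → ∣-trans d∣m (m∣m*n p))

μ-divisor-*-prime : ∀ {p} → Prime p → ∀ m e → 1 ≤ e →
  ⟦ e * p ∣? m * p ⟧ μ (e * p) ≡ ℤ.- ⟦ e ∣? m ⟧ ⟦ ¬? (p ∣? e) ⟧ μ e
μ-divisor-*-prime {p} p-prime m e 1≤e with e ∣? m
... | no e∤m = ⟦⟧-no ((e * p) ∣? m * p) (e∤m ∘ *-cancelʳ-∣ p {{prime⇒nonZero p-prime}})
... | yes e∣m with p ∣? e
...   | yes p∣e = trans (⟦⟧-yes ((e * p) ∣? m * p) (*-monoˡ-∣ p e∣m))
                        (trans (cong μ (ℕₚ.*-comm e p)) (μ-*-prime-∣ p-prime 1≤e p∣e))
...   | no  p∤e = trans (⟦⟧-yes ((e * p) ∣? m * p) (*-monoˡ-∣ p e∣m))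
                        (trans (cong μ (ℕₚ.*-comm e p)) (μ-*-prime-∤ p-prime 1≤e p∤e))

-- With a prime p ∣ g, the divisors dp cancel the divisors d with p ∤ d, as μ(dp) = −μ(d) for p ∤ d
-- and μ(dp) = 0 for p ∣ d.
∑-μ-divisors : ∀ g → 1 ≤ g → divisorSum g μ ≡ ⟦ g ≟ 1 ⟧ 1ℤ
∑-μ-divisors 1 _ = refl
∑-μ-divisors g@(suc (suc _)) _ with ∃-prime-divisor g (s≤s (s≤s z≤n))
... | p , p-prime , divides m g≡mp = begin
  divisorSum g μ
    ≡⟨ cong (λ x → divisorSum x μ) g≡mp ⟩
  ∑ mp F
    ≡⟨ ∑-cong mp (λ d _ _ → ⟦⟧-split (p ∣? d) (F d)) ⟩
  ∑ mp (λ d → ⟦ ¬? (p ∣? d) ⟧ F d ℤ.+ ⟦ p ∣? d ⟧ F d)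
    ≡⟨ ∑-+ mp _ _ ⟩
  ∑ mp (λ d → ⟦ ¬? (p ∣? d) ⟧ F d) ℤ.+ ∑ mp (λ d → ⟦ p ∣? d ⟧ F d)
    ≡⟨ cong₂ ℤ._+_ (∑-cong mp λ d _ _ → ⟦∤prime⟧-μ-divisor p-prime m d) (∑-multiples p {{p≢0}} m F) ⟩
  ∑ mp G ℤ.+ ∑ m (λ e → F (e * p))
    ≡⟨ cong₂ ℤ._+_ (∑-extend m≤mp beyond-m)
                   (trans (∑-cong m λ e 1≤e _ → μ-divisor-*-prime p-prime m e 1≤e) (∑-neg m G)) ⟩
  ∑ m G ℤ.+ ℤ.- ∑ m G
    ≡⟨ ℤₚ.+-inverseʳ (∑ m G) ⟩
  0ℤ ∎
  where
  open ≡-Reasoning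
  mp : ℕ
  mp = m * p
  p≢0 : NonZero p
  p≢0 = prime⇒nonZero p-prime
  1≤m : 1 ≤ m
  1≤m = ℕₚ.n≢0⇒n>0 λ m≡0 → ℕₚ.0≢1+n (sym (trans g≡mp (cong (_* p) m≡0)))
  m≤mp : m ≤ mp
  m≤mp = ℕₚ.m≤m*n m p {{p≢0}}
  F G : ℕ → ℤ
  F d = ⟦ d ∣? mp ⟧ μ d
  G e = ⟦ e ∣? m ⟧ ⟦ ¬? (p ∣? e) ⟧ μ e
  beyond-m : ∀ i → m < i → i ≤ mp → G i ≡ 0ℤ
  beyond-m i m<i _ = ⟦⟧-no (i ∣? m) (ℕₚ.<⇒≱ m<i ∘ ∣⇒≤ {{ℕ.>-nonZero 1≤m}})

-- Integers coprime to h

-- The junk value at d = 0 is never used: only positive divisors are summed over.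
infixl 7 _div_
_div_ : ℕ → ℕ → ℕ
N div zero  = 0
N div suc d = N ℕ./ suc d

coprimeCount : ℕ → ℕ → ℤ
coprimeCount h N = ∑ N (λ b → ⟦ gcd b h ≟ 1 ⟧ 1ℤ)

φ≡coprimeCount : ∀ h → + φ h ≡ coprimeCount h h
φ≡coprimeCount h = length-filter-range1 (λ m → gcd m h ≟ 1) h

⟦∣gcd⟧ : ∀ b h d (x : ℤ) → ⟦ d ∣? gcd b h ⟧ x ≡ ⟦ d ∣? h ⟧ ⟦ d ∣? b ⟧ x
⟦∣gcd⟧ b h d x with d ∣? h | d ∣? b
... | yes d∣h | yes d∣b = ⟦⟧-yes (d ∣? gcd b h) (gcd-greatest d∣b d∣h)
... | yes _   | no d∤b  = ⟦⟧-no (d ∣? gcd b h) (d∤b ∘ (λ d∣g → ∣-trans d∣g (gcd[m,n]∣m b h)))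
... | no d∤h  | _       = ⟦⟧-no (d ∣? gcd b h) (d∤h ∘ (λ d∣g → ∣-trans d∣g (gcd[m,n]∣n b h)))

⟦coprime⟧≡divisorSum-μ : ∀ h → 1 ≤ h → ∀ b → ⟦ gcd b h ≟ 1 ⟧ 1ℤ ≡ divisorSum h (λ d → ⟦ d ∣? b ⟧ μ d)
⟦coprime⟧≡divisorSum-μ h 1≤h b = begin
  ⟦ gcd b h ≟ 1 ⟧ 1ℤ                    ≡⟨ sym (∑-μ-divisors g 1≤g) ⟩
  divisorSum g μ                         ≡⟨ sym (∑-extend (gcd[m,n]≤n b h {{ℕ.>-nonZero 1≤h}}) beyond-g) ⟩
  ∑ h (λ d → ⟦ d ∣? g ⟧ μ d)             ≡⟨ ∑-cong h (λ d _ _ → ⟦∣gcd⟧ b h d (μ d)) ⟩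
  divisorSum h (λ d → ⟦ d ∣? b ⟧ μ d)    ∎
  where
  open ≡-Reasoning
  g : ℕ
  g = gcd b h
  1≤g : 1 ≤ g
  1≤g = ℕₚ.n≢0⇒n>0 (ℕₚ.<⇒≢ 1≤h ∘ sym ∘ gcd[m,n]≡0⇒n≡0 b)
  beyond-g : ∀ d → g < d → d ≤ h → ⟦ d ∣? g ⟧ μ d ≡ 0ℤ
  beyond-g d g<d _ = ⟦⟧-no (d ∣? g) (ℕₚ.<⇒≱ g<d ∘ ∣⇒≤ {{ℕ.>-nonZero 1≤g}})

∑-⟦∣⟧ : ∀ N h d → 1 ≤ d → ∑ N (λ b → ⟦ d ∣? h ⟧ ⟦ d ∣? b ⟧ μ d) ≡ ⟦ d ∣? h ⟧ (μ d ℤ.* + (N div d))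
∑-⟦∣⟧ N h d@(suc _) _ with d ∣? h
... | no _  = ∑-zero N λ _ _ _ → refl
... | yes _ = begin
  ∑ N (λ b → ⟦ d ∣? b ⟧ μ d)           ≡⟨ ∑-cong N (λ b _ _ → ⟦⟧-scale (d ∣? b) (μ d)) ⟩
  ∑ N (λ b → μ d ℤ.* ⟦ d ∣? b ⟧ 1ℤ)    ≡⟨ ∑-*ˡ N (μ d) _ ⟩
  μ d ℤ.* ∑ N (λ b → ⟦ d ∣? b ⟧ 1ℤ)    ≡⟨ cong (μ d ℤ.*_) (count-multiples N d) ⟩
  μ d ℤ.* + (N div d)                   ∎
  where open ≡-Reasoning

coprimeCount-μ : ∀ h → 1 ≤ h → ∀ N → coprimeCount h N ≡ divisorSum h (λ d → μ d ℤ.* + (N div d))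
coprimeCount-μ h 1≤h N = begin
  coprimeCount h N                                              ≡⟨ ∑-cong N (λ b _ _ → ⟦coprime⟧≡divisorSum-μ h 1≤h b) ⟩
  ∑ N (λ b → ∑ h (λ d → ⟦ d ∣? h ⟧ ⟦ d ∣? b ⟧ μ d))             ≡⟨ ∑-comm N h _ ⟩
  ∑ h (λ d → ∑ N (λ b → ⟦ d ∣? h ⟧ ⟦ d ∣? b ⟧ μ d))             ≡⟨ ∑-cong h (λ d 1≤d _ → ∑-⟦∣⟧ N h d 1≤d) ⟩
  divisorSum h (λ d → μ d ℤ.* + (N div d))                      ∎
  where open ≡-Reasoning

coprimeCount-multiple : ∀ h → 1 ≤ h → ∀ k → coprimeCount h (h * k) ≡ + (k * φ h)
coprimeCount-multiple h 1≤h k = begin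
  coprimeCount h (h * k)                                          ≡⟨ cong (coprimeCount h) (ℕₚ.*-comm h k) ⟩
  coprimeCount h (k * h)                                          ≡⟨ coprimeCount-μ h 1≤h (k * h) ⟩
  divisorSum h (λ d → μ d ℤ.* + (k * h div d))                    ≡⟨ ∑-cong h (λ d 1≤d _ → divisor-term d 1≤d) ⟩
  ∑ h (λ d → + k ℤ.* ⟦ d ∣? h ⟧ (μ d ℤ.* + (h div d)))            ≡⟨ ∑-*ˡ h (+ k) _ ⟩
  + k ℤ.* divisorSum h (λ d → μ d ℤ.* + (h div d))                ≡⟨ cong (+ k ℤ.*_) (sym (coprimeCount-μ h 1≤h h)) ⟩
  + k ℤ.* coprimeCount h h                                        ≡⟨ cong (+ k ℤ.*_) (sym (φ≡coprimeCount h)) ⟩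
  + k ℤ.* + φ h                                                   ≡⟨ sym (ℤₚ.pos-* k (φ h)) ⟩
  + (k * φ h)                                                     ∎
  where
  open ≡-Reasoning
  divisor-term : ∀ d → 1 ≤ d → ⟦ d ∣? h ⟧ (μ d ℤ.* + (k * h div d)) ≡ + k ℤ.* ⟦ d ∣? h ⟧ (μ d ℤ.* + (h div d))
  divisor-term d@(suc _) _ with d ∣? h
  ... | no _    = sym (ℤₚ.*-zeroʳ (+ k))
  ... | yes d∣h = begin
    μ d ℤ.* + (k * h ℕ./ d)             ≡⟨ cong (λ q → μ d ℤ.* + q) (*-/-assoc k d∣h) ⟩
    μ d ℤ.* + (k * (h ℕ./ d))           ≡⟨ cong (μ d ℤ.*_) (ℤₚ.pos-* k (h ℕ./ d)) ⟩
    μ d ℤ.* (+ k ℤ.* + (h ℕ./ d))       ≡⟨ swap (μ d) (+ k) (+ (h ℕ./ d)) ⟩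
    + k ℤ.* (μ d ℤ.* + (h ℕ./ d))       ∎
    where
    swap : ∀ a b c → a ℤ.* (b ℤ.* c) ≡ b ℤ.* (a ℤ.* c)
    swap = solve-∀

-- Numerators in the Farey sequence

𝒩-filter? : (k h : ℕ) (p : ℕ × ℕ) →
  Dec (((proj₁ p ≤ proj₂ p × gcd (proj₁ p) (proj₂ p) ≡ 1) × proj₁ p * k < proj₂ p) × proj₁ p ≡ h)
𝒩-filter? k h p = (((proj₁ p ≤? proj₂ p) ×-dec (gcd (proj₁ p) (proj₂ p) ≟ 1)) ×-dec (proj₁ p * k <? proj₂ p)) ×-dec (proj₁ p ≟ h)

fareyColumn : ℕ → List (ℕ × ℕ)
fareyColumn b = map (λ a → (a , b)) (range1 b)

𝒩≡length-filter : ∀ n k h → 𝒩 n k h ≡ length (filter (𝒩-filter? k h) (concatMap fareyColumn (range1 n)))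
𝒩≡length-filter n k h = cong length (trans (cong (filter H?) (filter-filter K? F? L)) (filter-filter H? (λ p → F? p ×-dec K? p) L))
  where
  F? : (p : ℕ × ℕ) → Dec (proj₁ p ≤ proj₂ p × gcd (proj₁ p) (proj₂ p) ≡ 1)
  F? p = (proj₁ p ≤? proj₂ p) ×-dec (gcd (proj₁ p) (proj₂ p) ≟ 1)
  K? : (p : ℕ × ℕ) → Dec (proj₁ p * k < proj₂ p)
  K? p = proj₁ p * k <? proj₂ p
  H? : (p : ℕ × ℕ) → Dec (proj₁ p ≡ h)
  H? p = proj₁ p ≟ h
  L : List (ℕ × ℕ)
  L = concatMap fareyColumn (range1 n)

length-filter-fareyColumn : ∀ k h → 1 ≤ h → 1 ≤ k → ∀ b →
  + length (filter (𝒩-filter? k h) (fareyColumn b)) ≡ ⟦ h * k <? b ⟧ ⟦ gcd b h ≟ 1 ⟧ 1ℤ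
length-filter-fareyColumn k h 1≤h 1≤k b = begin
  + length (filter (𝒩-filter? k h) (fareyColumn b))
    ≡⟨ cong +_ (length-filter-map (𝒩-filter? k h) (λ a → (a , b)) (range1 b)) ⟩
  + length (filter (λ a → 𝒩-filter? k h (a , b)) (range1 b))
    ≡⟨ length-filter-range1 (λ a → 𝒩-filter? k h (a , b)) b ⟩
  ∑ b (λ a → ⟦ 𝒩-filter? k h (a , b) ⟧ 1ℤ)
    ≡⟨ only-h ⟩
  ⟦ h * k <? b ⟧ ⟦ gcd b h ≟ 1 ⟧ 1ℤ ∎
  where
  open ≡-Reasoning
  only-h : ∑ b (λ a → ⟦ 𝒩-filter? k h (a , b) ⟧ 1ℤ) ≡ ⟦ h * k <? b ⟧ ⟦ gcd b h ≟ 1 ⟧ 1ℤ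
  only-h with h * k <? b
  ... | no  hk≮b = ∑-zero b λ a _ _ → ⟦⟧-no (𝒩-filter? k h (a , b)) λ { ((_ , hk<b) , refl) → hk≮b hk<b }
  ... | yes hk<b = trans (∑-single b h 1≤h h≤b λ a _ _ a≢h → ⟦⟧-no (𝒩-filter? k h (a , b)) (a≢h ∘ proj₂))
                         (⟦⟧-⇔ (𝒩-filter? k h (h , b)) (gcd b h ≟ 1)
                           (λ (((_ , coprime) , _) , _) → trans (gcd-comm b h) coprime)
                           (λ coprime → ((h≤b , trans (gcd-comm h b) coprime) , hk<b) , refl))
    where
    h≤b : h ≤ b
    h≤b = ℕₚ.≤-trans (ℕₚ.m≤m*n h k {{ℕ.>-nonZero 1≤k}}) (ℕₚ.<⇒≤ hk<b)

𝒩≡∑ : ∀ n k h → 1 ≤ h → 1 ≤ k → + 𝒩 n k h ≡ ∑ n (λ b → ⟦ h * k <? b ⟧ ⟦ gcd b h ≟ 1 ⟧ 1ℤ)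
𝒩≡∑ n k h 1≤h 1≤k = begin
  + 𝒩 n k h                                                         ≡⟨ cong +_ (𝒩≡length-filter n k h) ⟩
  + length (filter (𝒩-filter? k h) (concatMap fareyColumn (range1 n)))
                                                                    ≡⟨ length-filter-concatMap-range1 (𝒩-filter? k h) fareyColumn n ⟩
  ∑ n (λ b → + length (filter (𝒩-filter? k h) (fareyColumn b)))     ≡⟨ ∑-cong n (λ b _ _ → length-filter-fareyColumn k h 1≤h 1≤k b) ⟩
  ∑ n (λ b → ⟦ h * k <? b ⟧ ⟦ gcd b h ≟ 1 ⟧ 1ℤ)                     ∎
  where open ≡-Reasoning

coprimeCount≡kφ+𝒩 : ∀ n k h → 1 ≤ h → 1 ≤ k → k * h < n → coprimeCount h n ≡ + (k * φ h) ℤ.+ + 𝒩 n k h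
coprimeCount≡kφ+𝒩 n k h 1≤h 1≤k kh<n = begin
  coprimeCount h n
    ≡⟨ ∑-from _ (ℕₚ.<⇒≤ hk<n) ⟩
  coprimeCount h (h * k) ℤ.+ ∑ n (λ b → ⟦ h * k <? b ⟧ ⟦ gcd b h ≟ 1 ⟧ 1ℤ)
    ≡⟨ cong₂ ℤ._+_ (coprimeCount-multiple h 1≤h k) (sym (𝒩≡∑ n k h 1≤h 1≤k)) ⟩
  + (k * φ h) ℤ.+ + 𝒩 n k h ∎
  where
  open ≡-Reasoning
  hk<n : h * k < n
  hk<n = subst (_< n) (ℕₚ.*-comm k h) kh<n

ι : ℤ → ℚ
ι z = z / 1

fromℚᵘ-homo-+ : ∀ p q → ℚ.fromℚᵘ (p ℚᵘ.+ q) ≡ ℚ.fromℚᵘ p + ℚ.fromℚᵘ q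
fromℚᵘ-homo-+ p q = trans (ℚₚ.fromℚᵘ-cong p+q≃) (ℚₚ.fromℚᵘ-toℚᵘ _)
  where
  p+q≃ : p ℚᵘ.+ q ℚᵘ.≃ ℚ.toℚᵘ (ℚ.fromℚᵘ p + ℚ.fromℚᵘ q)
  p+q≃ = ℚᵘₚ.≃-trans (ℚᵘₚ.+-cong (ℚᵘₚ.≃-sym (ℚₚ.toℚᵘ-fromℚᵘ p)) (ℚᵘₚ.≃-sym (ℚₚ.toℚᵘ-fromℚᵘ q)))
                     (ℚᵘₚ.≃-sym (ℚₚ.toℚᵘ-homo-+ (ℚ.fromℚᵘ p) (ℚ.fromℚᵘ q)))

fromℚᵘ-homo-* : ∀ p q → ℚ.fromℚᵘ (p ℚᵘ.* q) ≡ ℚ.fromℚᵘ p ℚ.* ℚ.fromℚᵘ q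
fromℚᵘ-homo-* p q = trans (ℚₚ.fromℚᵘ-cong p*q≃) (ℚₚ.fromℚᵘ-toℚᵘ _)
  where
  p*q≃ : p ℚᵘ.* q ℚᵘ.≃ ℚ.toℚᵘ (ℚ.fromℚᵘ p ℚ.* ℚ.fromℚᵘ q)
  p*q≃ = ℚᵘₚ.≃-trans (ℚᵘₚ.*-cong (ℚᵘₚ.≃-sym (ℚₚ.toℚᵘ-fromℚᵘ p)) (ℚᵘₚ.≃-sym (ℚₚ.toℚᵘ-fromℚᵘ q)))
                     (ℚᵘₚ.≃-sym (ℚₚ.toℚᵘ-homo-* (ℚ.fromℚᵘ p) (ℚ.fromℚᵘ q)))

ι-+ : ∀ a b → ι (a ℤ.+ b) ≡ ι a + ι b
ι-+ a b = trans (ℚₚ.fromℚᵘ-cong {mkℚᵘ (a ℤ.+ b) 0} {mkℚᵘ a 0 ℚᵘ.+ mkℚᵘ b 0} (*≡* (cross a b)))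
                (fromℚᵘ-homo-+ (mkℚᵘ a 0) (mkℚᵘ b 0))
  where
  cross : ∀ a b → (a ℤ.+ b) ℤ.* + 1 ≡ (a ℤ.* + 1 ℤ.+ b ℤ.* + 1) ℤ.* + 1
  cross = solve-∀

ι-* : ∀ a b → ι (a ℤ.* b) ≡ ι a ℚ.* ι b
ι-* a b = trans (ℚₚ.fromℚᵘ-cong {mkℚᵘ (a ℤ.* b) 0} {mkℚᵘ a 0 ℚᵘ.* mkℚᵘ b 0} (*≡* refl))
                (fromℚᵘ-homo-* (mkℚᵘ a 0) (mkℚᵘ b 0))

⟋-multiple : ∀ n D H q → q * suc D ≡ suc H → n ⟋ suc D ≡ ι (+ n ℤ.* + q) ℚ.* (1 ⟋ suc H)
⟋-multiple n D H q qd≡h =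
  trans (ℚₚ.fromℚᵘ-cong {mkℚᵘ (+ n) D} {mkℚᵘ (+ n ℤ.* + q) 0 ℚᵘ.* mkℚᵘ (+ 1) H} (*≡* cross))
        (fromℚᵘ-homo-* (mkℚᵘ (+ n ℤ.* + q) 0) (mkℚᵘ (+ 1) H))
  where
  cross : + n ℤ.* + (1 * suc H) ≡ (+ n ℤ.* + q) ℤ.* + 1 ℤ.* + suc D
  cross = begin
    + n ℤ.* + (1 * suc H)               ≡⟨ cong (λ x → + n ℤ.* + x) (trans (ℕₚ.*-identityˡ (suc H)) (sym qd≡h)) ⟩
    + n ℤ.* + (q * suc D)               ≡⟨ cong (+ n ℤ.*_) (ℤₚ.pos-* q (suc D)) ⟩
    + n ℤ.* (+ q ℤ.* + suc D)           ≡⟨ reassoc (+ n) (+ q) (+ suc D) ⟩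
    (+ n ℤ.* + q) ℤ.* + 1 ℤ.* + suc D   ∎
    where
    open ≡-Reasoning
    reassoc : ∀ a b c → a ℤ.* (b ℤ.* c) ≡ (a ℤ.* b) ℤ.* + 1 ℤ.* c
    reassoc = solve-∀

/-cross : ∀ A b a D → A * suc D ≡ a * suc b → A ℕ./ suc b ≡ a ℕ./ suc D
/-cross A b a D Ad≡ab = begin
  A ℕ./ suc b                      ≡⟨ sym (m*n/o*n≡m/o A (suc D) (suc b)) ⟩
  A * suc D ℕ./ (suc b * suc D)    ≡⟨ /-congˡ {o = suc b * suc D} Ad≡ab ⟩
  a * suc b ℕ./ (suc b * suc D)    ≡⟨ /-congʳ {m = a * suc b} (ℕₚ.*-comm (suc b) (suc D)) ⟩
  a * suc b ℕ./ (suc D * suc b)    ≡⟨ m*n/o*n≡m/o a (suc b) (suc D) ⟩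
  a ℕ./ suc D                      ∎
  where open ≡-Reasoning

-- a ⟋ suc D is stored in lowest terms, so its floor is recovered through cross-multiplication.
floor-cross : ∀ p a D → ℚ.↥ p ℤ.* + suc D ≡ + a ℤ.* ℚ.↧ p → ℚ.floor p ≡ + (a ℕ./ suc D)
floor-cross (ℚ.mkℚ (+ A) b _) a D pD≡ab = trans (div-pos-is-/ℕ (+ A) (suc b)) (cong +_ (/-cross A b a D Ad≡ab))
  where
  Ad≡ab : A * suc D ≡ a * suc b
  Ad≡ab = ℤₚ.+-injective (trans (ℤₚ.pos-* A (suc D)) (trans pD≡ab (sym (ℤₚ.pos-* a (suc b)))))
floor-cross (ℚ.mkℚ ℤ.-[1+ _ ] b _) a D pD≡ab with trans pD≡ab (sym (ℤₚ.pos-* a (suc b)))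
... | ()

⟋-cross : ∀ a D → ℚ.↥ (a ⟋ suc D) ℤ.* + suc D ≡ + a ℤ.* ℚ.↧ (a ⟋ suc D)
⟋-cross a D with ℚₚ.toℚᵘ-fromℚᵘ (mkℚᵘ (+ a) D)
... | *≡* cross = trans (cong (ℤ._* + suc D) (sym (ℚₚ.↥ᵘ-toℚᵘ (a ⟋ suc D))))
                        (trans cross (cong (+ a ℤ.*_) (ℚₚ.↧ᵘ-toℚᵘ (a ⟋ suc D))))

floor-⟋ : ∀ a D → ℚ.floor (a ⟋ suc D) ≡ + (a ℕ./ suc D)
floor-⟋ a D = floor-cross (a ⟋ suc D) a D (⟋-cross a D)

sumℚ-++ : ∀ xs ys → sumℚ (xs ++ ys) ≡ sumℚ xs + sumℚ ys
sumℚ-++ []       ys = sym (ℚₚ.+-identityˡ _)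
sumℚ-++ (x ∷ xs) ys = trans (cong (λ s → x + s) (sumℚ-++ xs ys)) (sym (ℚₚ.+-assoc x _ _))

sumℚ-map-filter-range1-suc : {P : Pred ℕ 0ℓ} (P? : Decidable P) (f : ℕ → ℚ) → ∀ N →
  sumℚ (map f (filter P? (range1 (suc N)))) ≡ sumℚ (map f (filter P? (range1 N))) + sumℚ (map f (filter P? [ suc N ]))
sumℚ-map-filter-range1-suc P? f N = begin
  sumℚ (map f (filter P? (range1 (suc N))))
    ≡⟨ cong (λ l → sumℚ (map f (filter P? l))) (range1-suc N) ⟩
  sumℚ (map f (filter P? (range1 N ++ [ suc N ])))
    ≡⟨ cong (sumℚ ∘ map f) (Listₚ.filter-++ P? (range1 N) [ suc N ]) ⟩
  sumℚ (map f (filter P? (range1 N) ++ filter P? [ suc N ]))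
    ≡⟨ cong sumℚ (Listₚ.map-++ f (filter P? (range1 N)) _) ⟩
  sumℚ (map f (filter P? (range1 N)) ++ map f (filter P? [ suc N ]))
    ≡⟨ sumℚ-++ (map f (filter P? (range1 N))) _ ⟩
  sumℚ (map f (filter P? (range1 N))) + sumℚ (map f (filter P? [ suc N ])) ∎
  where open ≡-Reasoning

sumℚ-affine : {P : Pred ℕ 0ℓ} (P? : Decidable P) (f : ℕ → ℚ) (a b : ℕ → ℤ) (c : ℚ) →
  (∀ i → P i → f i ≡ ι (a i) ℚ.* c - ι (b i)) → ∀ N →
  sumℚ (map f (filter P? (range1 N))) ≡ ι (∑ N (λ i → ⟦ P? i ⟧ a i)) ℚ.* c - ι (∑ N (λ i → ⟦ P? i ⟧ b i))
sumℚ-affine P? f a b c f≡ zero    = solve 1 (λ c → con 0ℚ := con 0ℚ :* c :- con 0ℚ) refl c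
  where open +-*-Solver using (solve; con; _:*_; _:-_; _:=_)
sumℚ-affine P? f a b c f≡ (suc N) = begin
  sumℚ (map f (filter P? (range1 (suc N))))
    ≡⟨ sumℚ-map-filter-range1-suc P? f N ⟩
  sumℚ (map f (filter P? (range1 N))) + sumℚ (map f (filter P? [ suc N ]))
    ≡⟨ cong (_+ _) (sumℚ-affine P? f a b c f≡ N) ⟩
  ι A ℚ.* c - ι B + sumℚ (map f (filter P? [ suc N ]))
    ≡⟨ last-term ⟩
  ι (A ℤ.+ ⟦ P? (suc N) ⟧ a (suc N)) ℚ.* c - ι (B ℤ.+ ⟦ P? (suc N) ⟧ b (suc N)) ∎
  where
  open ≡-Reasoning
  open +-*-Solver using (solve; con; _:+_; _:*_; _:-_; _:=_)
  A B : ℤ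
  A = ∑ N (λ i → ⟦ P? i ⟧ a i)
  B = ∑ N (λ i → ⟦ P? i ⟧ b i)
  last-term : ι A ℚ.* c - ι B + sumℚ (map f (filter P? [ suc N ]))
              ≡ ι (A ℤ.+ ⟦ P? (suc N) ⟧ a (suc N)) ℚ.* c - ι (B ℤ.+ ⟦ P? (suc N) ⟧ b (suc N))
  last-term with P? (suc N)
  ... | yes P[1+N] = begin
    ι A ℚ.* c - ι B + (f (suc N) + 0ℚ)
      ≡⟨ cong (λ x → ι A ℚ.* c - ι B + (x + 0ℚ)) (f≡ (suc N) P[1+N]) ⟩
    ι A ℚ.* c - ι B + (ι (a (suc N)) ℚ.* c - ι (b (suc N)) + 0ℚ)
      ≡⟨ solve 5 (λ A B a b c → A :* c :- B :+ (a :* c :- b :+ con 0ℚ) := (A :+ a) :* c :- (B :+ b))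
                 refl (ι A) (ι B) (ι (a (suc N))) (ι (b (suc N))) c ⟩
    (ι A + ι (a (suc N))) ℚ.* c - (ι B + ι (b (suc N)))
      ≡⟨ sym (cong₂ (λ x y → x ℚ.* c - y) (ι-+ A (a (suc N))) (ι-+ B (b (suc N)))) ⟩
    ι (A ℤ.+ a (suc N)) ℚ.* c - ι (B ℤ.+ b (suc N))   ∎
  ... | no _ = begin
    ι A ℚ.* c - ι B + 0ℚ
      ≡⟨ solve 3 (λ A B c → A :* c :- B :+ con 0ℚ := (A :+ con 0ℚ) :* c :- (B :+ con 0ℚ)) refl (ι A) (ι B) c ⟩
    (ι A + 0ℚ) ℚ.* c - (ι B + 0ℚ)
      ≡⟨ sym (cong₂ (λ x y → x ℚ.* c - y) (ι-+ A 0ℤ) (ι-+ B 0ℤ)) ⟩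
    ι (A ℤ.+ 0ℤ) ℚ.* c - ι (B ℤ.+ 0ℤ)   ∎

μ-frac-divisor : ∀ n H d → d ∣ suc H →
  μ d / 1 ℚ.* frac (n ⟋ d) ≡ ι (+ n ℤ.* (μ d ℤ.* + (suc H div d))) ℚ.* (1 ⟋ suc H) - ι (μ d ℤ.* + (n div d))
μ-frac-divisor n H zero    0∣h = ⊥-elim (ℕₚ.0≢1+n (sym (0∣⇒≡0 0∣h)))
μ-frac-divisor n H (suc D) (divides Q h≡Qd) = begin
  ι m ℚ.* (n ⟋ suc D - ι (ℚ.floor (n ⟋ suc D)))
    ≡⟨ cong (λ x → ι m ℚ.* (n ⟋ suc D - ι x)) (floor-⟋ n D) ⟩
  ι m ℚ.* (n ⟋ suc D - ι (+ q))
    ≡⟨ cong (λ x → ι m ℚ.* (x - ι (+ q))) (⟋-multiple n D H Q (sym h≡Qd)) ⟩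
  ι m ℚ.* (ι (+ n ℤ.* + Q) ℚ.* c - ι (+ q))
    ≡⟨ cong (λ x → ι m ℚ.* (x ℚ.* c - ι (+ q))) (ι-* (+ n) (+ Q)) ⟩
  ι m ℚ.* (ι (+ n) ℚ.* ι (+ Q) ℚ.* c - ι (+ q))
    ≡⟨ solve 5 (λ m n Q c q → m :* (n :* Q :* c :- q) := n :* (m :* Q) :* c :- m :* q) refl (ι m) (ι (+ n)) (ι (+ Q)) c (ι (+ q)) ⟩
  ι (+ n) ℚ.* (ι m ℚ.* ι (+ Q)) ℚ.* c - ι m ℚ.* ι (+ q)
    ≡⟨ sym (cong₂ (λ x y → x ℚ.* c - y) (trans (ι-* (+ n) _) (cong (ι (+ n) ℚ.*_) (ι-* m (+ Q)))) (ι-* m (+ q))) ⟩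
  ι (+ n ℤ.* (m ℤ.* + Q)) ℚ.* c - ι (m ℤ.* + q)
    ≡⟨ cong (λ x → ι (+ n ℤ.* (m ℤ.* + x)) ℚ.* c - ι (m ℤ.* + q)) (sym h/d≡Q) ⟩
  ι (+ n ℤ.* (m ℤ.* + (suc H ℕ./ suc D))) ℚ.* c - ι (m ℤ.* + q) ∎
  where
  open ≡-Reasoning
  open +-*-Solver using (solve; _:*_; _:-_; _:=_)
  m : ℤ
  m = μ (suc D)
  q : ℕ
  q = n ℕ./ suc D
  c : ℚ
  c = 1 ⟋ suc H
  h/d≡Q : suc H ℕ./ suc D ≡ Q
  h/d≡Q = trans (/-congˡ h≡Qd) (m*n/n≡m Q (suc D))

divisorSum-frac : ∀ n H →
  sumℚ (map (λ d → (μ d / 1) ℚ.* frac (n ⟋ d)) (divisors (suc H)))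
    ≡ ι (+ n) ℚ.* ι (+ φ (suc H)) ℚ.* (1 ⟋ suc H) - ι (coprimeCount (suc H) n)
divisorSum-frac n H = begin
  sumℚ (map (λ d → (μ d / 1) ℚ.* frac (n ⟋ d)) (divisors h))
    ≡⟨ sumℚ-affine (λ d → d ∣? h) _ a b c (μ-frac-divisor n H) h ⟩
  ι (divisorSum h a) ℚ.* c - ι (divisorSum h b)
    ≡⟨ cong₂ (λ x y → ι x ℚ.* c - ι y) ∑a (sym (coprimeCount-μ h 1≤h n)) ⟩
  ι (+ n ℤ.* + φ h) ℚ.* c - ι (coprimeCount h n)
    ≡⟨ cong (λ x → x ℚ.* c - ι (coprimeCount h n)) (ι-* (+ n) _) ⟩
  ι (+ n) ℚ.* ι (+ φ h) ℚ.* c - ι (coprimeCount h n) ∎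
  where
  open ≡-Reasoning
  h : ℕ
  h = suc H
  c : ℚ
  c = 1 ⟋ h
  1≤h : 1 ≤ h
  1≤h = s≤s z≤n
  a b : ℕ → ℤ
  a d = + n ℤ.* (μ d ℤ.* + (h div d))
  b d = μ d ℤ.* + (n div d)
  ∑a : divisorSum h a ≡ + n ℤ.* + φ h
  ∑a = begin
    divisorSum h a                                        ≡⟨ ∑-cong h (λ d _ _ → ⟦⟧-*ˡ (d ∣? h) (+ n) _) ⟩
    ∑ h (λ d → + n ℤ.* ⟦ d ∣? h ⟧ (μ d ℤ.* + (h div d)))  ≡⟨ ∑-*ˡ h (+ n) _ ⟩
    + n ℤ.* divisorSum h (λ d → μ d ℤ.* + (h div d))      ≡⟨ cong (+ n ℤ.*_) (sym (coprimeCount-μ h 1≤h h)) ⟩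
    + n ℤ.* coprimeCount h h                              ≡⟨ cong (+ n ℤ.*_) (sym (φ≡coprimeCount h)) ⟩
    + n ℤ.* + φ h                                         ∎

corollary5 : (h n k : ℕ) → 0 < h → h < n → 0 < k → k * h < n →
    (+ 𝒩 n k h) / 1
      ≡ (n ⟋ 1) Data.Rational.* ((φ h) ⟋ h)
        - (k * φ h) ⟋ 1
        - sumℚ (map (λ d → (μ d / 1) Data.Rational.* frac (n ⟋ d)) (divisors h))
corollary5 h@(suc H) n k _ _ 1≤k kh<n = sym (begin
  x ℚ.* (φ h ⟋ h) - K - Σ                          ≡⟨ cong₂ (λ s t → x ℚ.* s - K - t) φ/h Σ≡ ⟩
  x ℚ.* (y ℚ.* c) - K - (x ℚ.* y ℚ.* c - (K + z))  ≡⟨ solve 5 (λ x y c K z → x :* (y :* c) :- K :- (x :* y :* c :- (K :+ z)) := z)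
                                                              refl x y c K z ⟩
  z                                                ∎)
  where
  open ≡-Reasoning
  open +-*-Solver using (solve; _:+_; _:*_; _:-_; _:=_)
  x y c K z Σ : ℚ
  x = n ⟋ 1
  y = ι (+ φ h)
  c = 1 ⟋ h
  K = (k * φ h) ⟋ 1
  z = ι (+ 𝒩 n k h)
  Σ = sumℚ (map (λ d → (μ d / 1) ℚ.* frac (n ⟋ d)) (divisors h))
  φ/h : φ h ⟋ h ≡ y ℚ.* c
  φ/h = trans (⟋-multiple (φ h) H H 1 (ℕₚ.*-identityˡ h)) (cong (λ t → ι t ℚ.* c) (ℤₚ.*-identityʳ (+ φ h)))
  Σ≡ : Σ ≡ x ℚ.* y ℚ.* c - (K + z)
  Σ≡ = trans (divisorSum-frac n H) (cong (λ t → x ℚ.* y ℚ.* c - t) C≡K+z)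
    where
    C≡K+z : ι (coprimeCount h n) ≡ K + z
    C≡K+z = trans (cong ι (coprimeCount≡kφ+𝒩 n k h (s≤s z≤n) 1≤k kh<n)) (ι-+ (+ (k * φ h)) (+ 𝒩 n k h))
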